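{- For every integer $n>0$, $\mu(P_1^n,P_1^n)=1$ and $$\mu(P_1^n,P_2^n)=\begin{cases}-1,&n=1,\\0,&n>1.\end{cases}$$
   Context: $\mathcal{G}$ is the poset of all finite unlabelled graphs (loops and multiple edges allowed), up to isomorphism, with $H\le G$ iff $H$ is isomorphic to an induced subgraph of $G$; $\mu$ is its Möbius function ($\mu(a,a)=1$, $\mu(a,b)=0$ if $a\not\le b$, $\mu(a,b)=-\sum_{a\le c<b}\mu(a,c)$ if $a<b$). $P_a$ is the path graph with $a$ vertices, and $P_a^n$ is the disjoint union of $n$ copies of $P_a$ (so $P_1^n$ has $n$ isolated vertices and $P_2^n$ is a perfect matching on $2n$ vertices). -}

module Defs where

open import Data.Nat as ℕ using (ℕ; zero; suc; _+_; _≡ᵇ_)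
open import Data.Bool using (Bool; true; false; if_then_else_; _∨_)
open import Data.Bool.Properties using (∨-comm)
open import Data.Fin using (Fin; toℕ; splitAt)
open import Data.Sum using (_⊎_; inj₁; inj₂)
open import Data.Product using (Σ; _×_; _,_; proj₁; proj₂)
open import Data.Integer as ℤ using (ℤ)
open import Data.List using (List; []; _∷_; map; foldr)
open import Data.List.Relation.Unary.All using (All)
open import Data.List.Relation.Unary.Any using (Any)
open import Data.List.Relation.Unary.AllPairs using (AllPairs)
open import Relation.Binary.PropositionalEquality using (_≡_; refl; cong)
open import Relation.Nullary using (¬_)
open import Function.Bundles using (_↔_; _↣_; Inverse; Injection)

-- Finite undirected graph with loops and multiple edges, vertex set Fin size;
-- adj i j = number of edges between i and j (adj i i = number of loops at i).
record Graph : Set where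
  constructor graph
  field
    size    : ℕ
    adj     : Fin size → Fin size → ℕ
    adj-sym : ∀ i j → adj i j ≡ adj j i
open Graph public

-- Isomorphism of graphs (equality in the poset of unlabelled graphs).
_≅_ : Graph → Graph → Set
G ≅ H = Σ (Fin (size G) ↔ Fin (size H)) λ σ →
          ∀ i j → adj H (Inverse.to σ i) (Inverse.to σ j) ≡ adj G i j

_≤G_ : Graph → Graph → Set
H ≤G G = Σ (Fin (size H) ↣ Fin (size G)) λ f →
           ∀ i j → adj G (Injection.to f i) (Injection.to f j) ≡ adj H i j

_<G_ : Graph → Graph → Set
H <G G = (H ≤G G) × ¬ (H ≅ G)

_⊕_ : Graph → Graph → Graph
G ⊕ H = graph (size G + size H) A Asym
  where
  A' : Fin (size G) ⊎ Fin (size H) → Fin (size G) ⊎ Fin (size H) → ℕ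
  A' (inj₁ i) (inj₁ j) = adj G i j
  A' (inj₁ i) (inj₂ j) = 0
  A' (inj₂ i) (inj₁ j) = 0
  A' (inj₂ i) (inj₂ j) = adj H i j
  A'sym : ∀ x y → A' x y ≡ A' y x
  A'sym (inj₁ i) (inj₁ j) = adj-sym G i j
  A'sym (inj₁ i) (inj₂ j) = refl
  A'sym (inj₂ i) (inj₁ j) = refl
  A'sym (inj₂ i) (inj₂ j) = adj-sym H i j
  A : Fin (size G + size H) → Fin (size G + size H) → ℕ
  A i j = A' (splitAt (size G) i) (splitAt (size G) j)
  Asym : ∀ i j → A i j ≡ A j i
  Asym i j = A'sym (splitAt (size G) i) (splitAt (size G) j)

emptyGraph : Graph
emptyGraph = graph 0 (λ ()) (λ ())

copies : ℕ → Graph → Graph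
copies zero    G = emptyGraph
copies (suc n) G = G ⊕ copies n G

pathAdj : ℕ → ℕ → ℕ
pathAdj i j = if (i ≡ᵇ suc j) ∨ (j ≡ᵇ suc i) then 1 else 0

pathAdj-sym : ∀ i j → pathAdj i j ≡ pathAdj j i
pathAdj-sym i j = cong (λ b → if b then 1 else 0) (∨-comm (i ≡ᵇ suc j) (j ≡ᵇ suc i))

Path : ℕ → Graph
Path a = graph a (λ i j → pathAdj (toℕ i) (toℕ j)) (λ i j → pathAdj-sym (toℕ i) (toℕ j))

P : ℕ → ℕ → Graph
P a n = copies n (Path a)

sumℤ : List ℤ → ℤ
sumℤ = foldr ℤ._+_ (ℤ.+ 0)

-- Möbius a b z  means  μ(a,b) = z, defined inductively following
--   μ(a,a) = 1,  μ(a,b) = 0 if a ≰ b,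
--   μ(a,b) = - Σ_{a ≤ c < b} μ(a,c) if a < b,
-- where the sum ranges over isomorphism classes c, given by a list cs of
-- representatives (paired with the values μ(a,c)) that is complete,
-- contained in the interval [a,b), and pairwise non-isomorphic.
data Möbius (a : Graph) : Graph → ℤ → Set where
  μ-iso  : ∀ {b} → a ≅ b → Möbius a b (ℤ.+ 1)
  μ-nle  : ∀ {b} → ¬ (a ≤G b) → Möbius a b (ℤ.+ 0)
  μ-step : ∀ {b} → a ≤G b → ¬ (a ≅ b) →
           (cs : List (Graph × ℤ)) →
           All (λ p → Möbius a (proj₁ p) (proj₂ p)) cs →
           All (λ p → (a ≤G proj₁ p) × (proj₁ p <G b)) cs →
           (∀ c → a ≤G c → c <G b → Any (λ p → c ≅ proj₁ p) cs) →
           AllPairs (λ p q → ¬ (proj₁ p ≅ proj₁ q)) cs →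
           Möbius a b (ℤ.- sumℤ (map proj₂ cs))

-- A graph c with P₁ⁿ ≤ c < P₂ⁿ is an induced subgraph of a perfect matching, hence
-- itself a matching, i.e. isomorphic to P₂ʲ ⊔ P₁ʳ (peel off vertex 0, together with its
-- neighbour if it has one).  Its independence number j + r is at least n because c
-- contains P₁ⁿ, and at most n because c lies below P₂ⁿ, which is covered by n cliques.
-- So r = n ∸ j, and vertex counts order these graphs: the interval [P₁ⁿ, P₂ⁿ] is the
-- chain C₀ < C₁ < ⋯ < Cₙ with Cₖ = P₂ᵏ ⊔ P₁ⁿ⁻ᵏ, on which μ(C₀, Cₖ) is 1, -1, 0, 0, …
module Submission where

open import Defs
open import Data.Nat using (ℕ; zero; suc; _+_; _*_; _∸_; _≤_; _<_; z≤n; s≤s)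
open import Data.Nat.Properties
  using (_≟_; ≤-refl; ≤-trans; ≤-antisym; ≤-pred; <⇒≤; <⇒≢; ≤∧≢⇒<; n<1⇒n≡0; 0≢1+n; 1+n≢0;
         *-identityʳ; +-comm; +-∸-assoc; m∸n+n≡m; m+[n∸m]≡n; m+n∸m≡n; n∸n≡0; +-cancelʳ-≡; +-cancelʳ-≤)
open import Data.Nat.Solver using (module +-*-Solver)
open +-*-Solver using (solve; _:+_; _:*_; con; _:=_)
open import Data.Fin as Fin using (Fin; suc; splitAt)
open import Data.Fin.Patterns using (0F; 1F)
open import Data.Fin.Permutation using (transpose; ↔⇒≡)
open import Data.Fin.Properties using (+↔⊎; suc-injective; any?; injective⇒≤)
open import Data.Empty using (⊥-elim)
open import Data.Sum as Sum using (_⊎_; inj₁; inj₂)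
open import Data.Sum.Properties using (inj₁-injective; inj₂-injective)
open import Data.Sum.Function.Propositional using (_⊎-↔_; _⊎-↣_)
open import Data.Sum.Algebra using (⊎-comm; ⊎-assoc)
open import Data.Product using (Σ; ∃₂; ∃-syntax; _×_; _,_; proj₁; proj₂)
open import Data.Integer using (ℤ; +_; -[1+_]; -_)
open import Data.Integer.Properties using (+-identityˡ)
open import Data.List using (List; []; _∷_; map)
open import Data.List.Relation.Unary.All as All using (All; []; _∷_)
open import Data.List.Relation.Unary.Any using (Any; here; there)
open import Data.List.Relation.Unary.AllPairs using (AllPairs; []; _∷_)
open import Function using (_∘_; id)
open import Function.Definitions using (Injective)
open import Function.Bundles using (_↔_; _↣_; Inverse; Injection; mk↣)
open import Function.Properties.Inverse using (↔-refl; ↔-sym; ↔-trans; ↔⇒↣)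
open import Function.Construct.Composition using (_↣-∘_)
open import Relation.Binary.PropositionalEquality
open import Relation.Binary.Bundles using (Preorder)
import Relation.Binary.Reasoning.Preorder as PreorderReasoning
open import Relation.Nullary using (¬_; yes; no)

Adj : Set → Set
Adj X = X → X → ℕ

private variable
  X Y Z X′ Y′ : Set

infix 4 _≅ᴬ_ _≤ᴬ_
infixr 6 _⊕ᴬ_

-- Records rather than Σ-types (as _≅_ and _≤G_ in Defs): Agda cannot recover the
-- adjacency functions from an unfolded Σ-type, but it can from a record type.
record _≅ᴬ_ (A : Adj X) (B : Adj Y) : Set where
  constructor _,_
  field
    bijection : X ↔ Y
    preserves : ∀ i j → B (Inverse.to bijection i) (Inverse.to bijection j) ≡ A i j

record _≤ᴬ_ (A : Adj X) (B : Adj Y) : Set where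
  constructor _,_
  field
    embedding : X ↣ Y
    preserves : ∀ i j → B (Injection.to embedding i) (Injection.to embedding j) ≡ A i j

_⊕ᴬ_ : Adj X → Adj Y → Adj (X ⊎ Y)
(A ⊕ᴬ B) (inj₁ i) (inj₁ j) = A i j
(A ⊕ᴬ B) (inj₂ i) (inj₂ j) = B i j
(A ⊕ᴬ B) _        _        = 0

≅ᴬ-refl : {A : Adj X} → A ≅ᴬ A
≅ᴬ-refl = ↔-refl , λ _ _ → refl

≅ᴬ-sym : {A : Adj X} {B : Adj Y} → A ≅ᴬ B → B ≅ᴬ A
≅ᴬ-sym {B = B} (σ , p) = ↔-sym σ , λ i j →
  trans (sym (p _ _)) (cong₂ B (Inverse.strictlyInverseˡ σ i) (Inverse.strictlyInverseˡ σ j))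

≅ᴬ-trans : {A : Adj X} {B : Adj Y} {C : Adj Z} → A ≅ᴬ B → B ≅ᴬ C → A ≅ᴬ C
≅ᴬ-trans (σ , p) (τ , q) = ↔-trans σ τ , λ i j → trans (q _ _) (p i j)

≅ᴬ⇒≤ᴬ : {A : Adj X} {B : Adj Y} → A ≅ᴬ B → A ≤ᴬ B
≅ᴬ⇒≤ᴬ (σ , p) = ↔⇒↣ σ , p

≤ᴬ-trans : {A : Adj X} {B : Adj Y} {C : Adj Z} → A ≤ᴬ B → B ≤ᴬ C → A ≤ᴬ C
≤ᴬ-trans (f , p) (g , q) = g ↣-∘ f , λ i j → trans (q _ _) (p i j)

module _ {A : Adj X} {A′ : Adj X′} {B : Adj Y} {B′ : Adj Y′} where

  ⊕ᴬ-cong : A ≅ᴬ A′ → B ≅ᴬ B′ → A ⊕ᴬ B ≅ᴬ A′ ⊕ᴬ B′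
  ⊕ᴬ-cong (σ , p) (τ , q) = (σ ⊎-↔ τ) , λ where
    (inj₁ i) (inj₁ j) → p i j
    (inj₁ i) (inj₂ j) → refl
    (inj₂ i) (inj₁ j) → refl
    (inj₂ i) (inj₂ j) → q i j

  ⊕ᴬ-mono : A ≤ᴬ A′ → B ≤ᴬ B′ → A ⊕ᴬ B ≤ᴬ A′ ⊕ᴬ B′
  ⊕ᴬ-mono (f , p) (g , q) = (f ⊎-↣ g) , λ where
    (inj₁ i) (inj₁ j) → p i j
    (inj₁ i) (inj₂ j) → refl
    (inj₂ i) (inj₁ j) → refl
    (inj₂ i) (inj₂ j) → q i j

⊕ᴬ-comm : (A : Adj X) (B : Adj Y) → A ⊕ᴬ B ≅ᴬ B ⊕ᴬ A
⊕ᴬ-comm A B = ⊎-comm _ _ , λ where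
  (inj₁ i) (inj₁ j) → refl
  (inj₁ i) (inj₂ j) → refl
  (inj₂ i) (inj₁ j) → refl
  (inj₂ i) (inj₂ j) → refl

⊕ᴬ-assoc : (A : Adj X) (B : Adj Y) (C : Adj Z) → (A ⊕ᴬ B) ⊕ᴬ C ≅ᴬ A ⊕ᴬ (B ⊕ᴬ C)
⊕ᴬ-assoc A B C = ⊎-assoc _ _ _ _ , λ where
  (inj₁ (inj₁ i)) (inj₁ (inj₁ j)) → refl
  (inj₁ (inj₁ i)) (inj₁ (inj₂ j)) → refl
  (inj₁ (inj₁ i)) (inj₂ j)        → refl
  (inj₁ (inj₂ i)) (inj₁ (inj₁ j)) → refl
  (inj₁ (inj₂ i)) (inj₁ (inj₂ j)) → refl
  (inj₁ (inj₂ i)) (inj₂ j)        → refl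
  (inj₂ i)        (inj₁ (inj₁ j)) → refl
  (inj₂ i)        (inj₁ (inj₂ j)) → refl
  (inj₂ i)        (inj₂ j)        → refl

≅⇒≅ᴬ : ∀ {G H} → G ≅ H → adj G ≅ᴬ adj H
≅⇒≅ᴬ (σ , p) = σ , p

≅ᴬ⇒≅ : ∀ {G H} → adj G ≅ᴬ adj H → G ≅ H
≅ᴬ⇒≅ (σ , p) = σ , p

≤G⇒≤ᴬ : ∀ {G H} → G ≤G H → adj G ≤ᴬ adj H
≤G⇒≤ᴬ (f , p) = f , p

≤ᴬ⇒≤G : ∀ {G H} → adj G ≤ᴬ adj H → G ≤G H
≤ᴬ⇒≤G (f , p) = f , p

adj-⊕ : (G H : Graph) → adj (G ⊕ H) ≅ᴬ adj G ⊕ᴬ adj H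
adj-⊕ G H = +↔⊎ , split
  where
  split : ∀ i j → (adj G ⊕ᴬ adj H) (splitAt (size G) i) (splitAt (size G) j) ≡ adj (G ⊕ H) i j
  split i j with splitAt (size G) i | splitAt (size G) j
  ... | inj₁ x | inj₁ y = refl
  ... | inj₁ x | inj₂ y = refl
  ... | inj₂ x | inj₁ y = refl
  ... | inj₂ x | inj₂ y = refl

≅-refl : ∀ {G} → G ≅ G
≅-refl {G} = ≅ᴬ⇒≅ {G} {G} ≅ᴬ-refl

≅-sym : ∀ {G H} → G ≅ H → H ≅ G
≅-sym {G} {H} p = ≅ᴬ⇒≅ {H} {G} (≅ᴬ-sym (≅⇒≅ᴬ {G} {H} p))

≅-trans : ∀ {G H K} → G ≅ H → H ≅ K → G ≅ K
≅-trans {G} {H} {K} p q = ≅ᴬ⇒≅ {G} {K} (≅ᴬ-trans (≅⇒≅ᴬ {G} {H} p) (≅⇒≅ᴬ {H} {K} q))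

≅⇒≤G : ∀ {G H} → G ≅ H → G ≤G H
≅⇒≤G {G} {H} p = ≤ᴬ⇒≤G {G} {H} (≅ᴬ⇒≤ᴬ (≅⇒≅ᴬ {G} {H} p))

≤G-refl : ∀ {G} → G ≤G G
≤G-refl {G} = ≅⇒≤G {G} {G} (≅-refl {G})

≤G-trans : ∀ {G H K} → G ≤G H → H ≤G K → G ≤G K
≤G-trans {G} {H} {K} p q = ≤ᴬ⇒≤G {G} {K} (≤ᴬ-trans (≤G⇒≤ᴬ {G} {H} p) (≤G⇒≤ᴬ {H} {K} q))

<G-respʳ-≅ : ∀ {c b b′} → b ≅ b′ → c <G b → c <G b′
<G-respʳ-≅ {c} {b} {b′} b≅b′ (c≤b , c≇b) =
  ≤G-trans {c} {b} {b′} c≤b (≅⇒≤G {b} {b′} b≅b′) ,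
  λ c≅b′ → c≇b (≅-trans {c} {b′} {b} c≅b′ (≅-sym {b} {b′} b≅b′))

≅-size : ∀ {G H} → G ≅ H → size G ≡ size H
≅-size (σ , _) = ↔⇒≡ σ

≤G-size : ∀ {G H} → G ≤G H → size G ≤ size H
≤G-size (f , _) = injective⇒≤ (Injection.injective f)

≤G-preorder : Preorder _ _ _
≤G-preorder = record
  { Carrier    = Graph
  ; _≈_        = _≅_
  ; _≲_        = _≤G_
  ; isPreorder = record
    { isEquivalence = record
      { refl  = λ {G} → ≅-refl {G}
      ; sym   = λ {G H} → ≅-sym {G} {H}
      ; trans = λ {G H K} → ≅-trans {G} {H} {K}
      }
    ; reflexive = λ {G H} → ≅⇒≤G {G} {H}
    ; trans     = λ {G H K} → ≤G-trans {G} {H} {K}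
    }
  }

module ≤G-Reasoning = PreorderReasoning ≤G-preorder

private variable
  G G′ H H′ K : Graph

≅-via : ∀ G H {A : Adj X} {B : Adj Y} → adj G ≅ᴬ A → adj H ≅ᴬ B → A ≅ᴬ B → G ≅ H
≅-via G H p q r = ≅ᴬ⇒≅ {G} {H} (≅ᴬ-trans p (≅ᴬ-trans r (≅ᴬ-sym q)))

⊕-cong : G ≅ G′ → H ≅ H′ → (G ⊕ H) ≅ (G′ ⊕ H′)
⊕-cong {G} {G′} {H} {H′} p q =
  ≅-via (G ⊕ H) (G′ ⊕ H′) (adj-⊕ G H) (adj-⊕ G′ H′) (⊕ᴬ-cong (≅⇒≅ᴬ {G} {G′} p) (≅⇒≅ᴬ {H} {H′} q))

⊕-mono : G ≤G G′ → H ≤G H′ → (G ⊕ H) ≤G (G′ ⊕ H′)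
⊕-mono {G} {G′} {H} {H′} p q = ≤ᴬ⇒≤G {G ⊕ H} {G′ ⊕ H′}
  (≤ᴬ-trans (≅ᴬ⇒≤ᴬ (adj-⊕ G H))
    (≤ᴬ-trans (⊕ᴬ-mono (≤G⇒≤ᴬ {G} {G′} p) (≤G⇒≤ᴬ {H} {H′} q)) (≅ᴬ⇒≤ᴬ (≅ᴬ-sym (adj-⊕ G′ H′)))))

⊕-comm : ∀ G H → (G ⊕ H) ≅ (H ⊕ G)
⊕-comm G H = ≅-via (G ⊕ H) (H ⊕ G) (adj-⊕ G H) (adj-⊕ H G) (⊕ᴬ-comm (adj G) (adj H))

⊕-assoc : ∀ G H K → ((G ⊕ H) ⊕ K) ≅ (G ⊕ (H ⊕ K))
⊕-assoc G H K =
  ≅-via ((G ⊕ H) ⊕ K) (G ⊕ (H ⊕ K))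
    (≅ᴬ-trans (adj-⊕ (G ⊕ H) K) (⊕ᴬ-cong (adj-⊕ G H) ≅ᴬ-refl))
    (≅ᴬ-trans (adj-⊕ G (H ⊕ K)) (⊕ᴬ-cong ≅ᴬ-refl (adj-⊕ H K)))
    (⊕ᴬ-assoc (adj G) (adj H) (adj K))

⊕-identityˡ : ∀ G → (emptyGraph ⊕ G) ≅ G
⊕-identityˡ G = ≅-refl {G}

⊕-identityʳ : ∀ G → (G ⊕ emptyGraph) ≅ G
⊕-identityʳ G = ≅-trans {G ⊕ emptyGraph} {emptyGraph ⊕ G} {G} (⊕-comm G emptyGraph) (⊕-identityˡ G)

copies-+ : ∀ m n G → copies (m + n) G ≅ (copies m G ⊕ copies n G)
copies-+ zero    n G = ≅-sym {emptyGraph ⊕ copies n G} {copies n G} (⊕-identityˡ (copies n G))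
copies-+ (suc m) n G = begin-equality
  G ⊕ copies (m + n) G             ≈⟨ ⊕-cong (≅-refl {G}) (copies-+ m n G) ⟩
  G ⊕ (copies m G ⊕ copies n G)    ≈⟨ ⊕-assoc G (copies m G) (copies n G) ⟨
  (G ⊕ copies m G) ⊕ copies n G    ∎
  where open ≤G-Reasoning

copies-mono : ∀ n → H ≤G G → copies n H ≤G copies n G
copies-mono zero    _ = ≤G-refl {emptyGraph}
copies-mono (suc n) p = ⊕-mono p (copies-mono n p)

size-copies : ∀ n G → size (copies n G) ≡ n * size G
size-copies zero    G = refl
size-copies (suc n) G = cong (λ m → size G + m) (size-copies n G)

P₁ P₂ : Graph
P₁ = Path 1
P₂ = Path 2

P₁≤P₂ : P₁ ≤G P₂
P₁≤P₂ = mk↣ {to = λ _ → 0F} (λ { {0F} {0F} _ → refl }) , λ { 0F 0F → refl }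

matchingGraph : ℕ → ℕ → Graph
matchingGraph j r = copies j P₂ ⊕ copies r P₁

size-matchingGraph : ∀ j r → size (matchingGraph j r) ≡ j + (j + r)
size-matchingGraph j r = begin
  size (copies j P₂) + size (copies r P₁)   ≡⟨ cong₂ _+_ (size-copies j P₂) (size-copies r P₁) ⟩
  j * 2 + r * 1                             ≡⟨ solve 2 (λ j r → j :* con 2 :+ r :* con 1 := j :+ (j :+ r))
                                                      refl j r ⟩
  j + (j + r)                               ∎
  where open ≡-Reasoning

matchingGraph-mono : ∀ j d s → matchingGraph j (d + s) ≤G matchingGraph (j + d) s
matchingGraph-mono j d s = begin
  copies j P₂ ⊕ copies (d + s) P₁              ≈⟨ ⊕-cong (≅-refl {copies j P₂}) (copies-+ d s P₁) ⟩
  copies j P₂ ⊕ (copies d P₁ ⊕ copies s P₁)    ≈⟨ ⊕-assoc (copies j P₂) (copies d P₁) (copies s P₁) ⟨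
  (copies j P₂ ⊕ copies d P₁) ⊕ copies s P₁    ≲⟨ ⊕-mono (⊕-mono (≤G-refl {copies j P₂}) (copies-mono d P₁≤P₂))
                                                         (≤G-refl {copies s P₁}) ⟩
  (copies j P₂ ⊕ copies d P₂) ⊕ copies s P₁    ≈⟨ ⊕-cong (copies-+ j d P₂) (≅-refl {copies s P₁}) ⟨
  copies (j + d) P₂ ⊕ copies s P₁              ∎
  where open ≤G-Reasoning

P₁⊕matchingGraph : ∀ j r → (P₁ ⊕ matchingGraph j r) ≅ matchingGraph j (suc r)
P₁⊕matchingGraph j r = begin-equality
  P₁ ⊕ (copies j P₂ ⊕ copies r P₁)    ≈⟨ ⊕-assoc P₁ (copies j P₂) (copies r P₁) ⟨
  (P₁ ⊕ copies j P₂) ⊕ copies r P₁    ≈⟨ ⊕-cong (⊕-comm P₁ (copies j P₂)) (≅-refl {copies r P₁}) ⟩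
  (copies j P₂ ⊕ P₁) ⊕ copies r P₁    ≈⟨ ⊕-assoc (copies j P₂) P₁ (copies r P₁) ⟩
  copies j P₂ ⊕ (P₁ ⊕ copies r P₁)    ∎
  where open ≤G-Reasoning

P₂⊕matchingGraph : ∀ j r → (P₂ ⊕ matchingGraph j r) ≅ matchingGraph (suc j) r
P₂⊕matchingGraph j r =
  ≅-sym {matchingGraph (suc j) r} {P₂ ⊕ matchingGraph j r} (⊕-assoc P₂ (copies j P₂) (copies r P₁))

-- Matchings

record IsMatching (A : Adj X) : Set where
  field
    loopless         : ∀ i → A i i ≡ 0
    simple           : ∀ i j → A i j ≤ 1
    unique-neighbour : ∀ {i j k} → A i j ≡ 1 → A i k ≡ 1 → j ≡ k

  ≢1⇒≡0 : ∀ {i j} → A i j ≢ 1 → A i j ≡ 0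
  ≢1⇒≡0 {i} {j} ne = n<1⇒n≡0 (≤∧≢⇒< (simple i j) ne)

  non-neighbour : ∀ {i j k} → A i j ≡ 1 → k ≢ j → A i k ≡ 0
  non-neighbour e k≢j = ≢1⇒≡0 λ e′ → k≢j (sym (unique-neighbour e e′))

open IsMatching

IsMatching-≤ᴬ : {A : Adj X} {B : Adj Y} → A ≤ᴬ B → IsMatching B → IsMatching A
IsMatching-≤ᴬ (f , p) μ = record
  { loopless         = λ i → trans (sym (p i i)) (loopless μ _)
  ; simple           = λ i j → subst (_≤ 1) (p i j) (simple μ _ _)
  ; unique-neighbour = λ {i} {j} {k} e e′ →
      Injection.injective f (unique-neighbour μ (trans (p i j) e) (trans (p i k) e′))
  }

IsMatching-⊕ᴬ : {A : Adj X} {B : Adj Y} → IsMatching A → IsMatching B → IsMatching (A ⊕ᴬ B)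
IsMatching-⊕ᴬ {A = A} {B = B} μ ν = record
  { loopless = λ where
      (inj₁ i) → loopless μ i
      (inj₂ i) → loopless ν i
  ; simple = λ where
      (inj₁ i) (inj₁ j) → simple μ i j
      (inj₁ i) (inj₂ j) → z≤n
      (inj₂ i) (inj₁ j) → z≤n
      (inj₂ i) (inj₂ j) → simple ν i j
  ; unique-neighbour = λ {i j k} → unique {i} {j} {k}
  }
  where
  unique : ∀ {i j k} → (A ⊕ᴬ B) i j ≡ 1 → (A ⊕ᴬ B) i k ≡ 1 → j ≡ k
  unique {inj₁ i} {inj₁ j} {inj₁ k} e e′ = cong inj₁ (unique-neighbour μ e e′)
  unique {inj₂ i} {inj₂ j} {inj₂ k} e e′ = cong inj₂ (unique-neighbour ν e e′)
  unique {inj₁ i} {inj₁ j} {inj₂ k} _ ()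
  unique {inj₁ i} {inj₂ j}          () _
  unique {inj₂ i} {inj₁ j}          () _
  unique {inj₂ i} {inj₂ j} {inj₁ k} _ ()

isMatching-⊕ : IsMatching (adj G) → IsMatching (adj H) → IsMatching (adj (G ⊕ H))
isMatching-⊕ {G} {H} μ ν = IsMatching-≤ᴬ (≅ᴬ⇒≤ᴬ (adj-⊕ G H)) (IsMatching-⊕ᴬ μ ν)

isMatching-copies : ∀ n → IsMatching (adj G) → IsMatching (adj (copies n G))
isMatching-copies zero    μ = record { loopless = λ () ; simple = λ () ; unique-neighbour = λ { {()} } }
isMatching-copies (suc n) μ = isMatching-⊕ μ (isMatching-copies n μ)

isMatching-P₂ : IsMatching (adj P₂)
isMatching-P₂ = record
  { loopless = λ where
      0F → refl
      1F → refl
  ; simple = λ where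
      0F 0F → z≤n
      0F 1F → s≤s z≤n
      1F 0F → s≤s z≤n
      1F 1F → z≤n
  ; unique-neighbour = λ {i j k} → unique {i} {j} {k}
  }
  where
  unique : ∀ {i j k} → adj P₂ i j ≡ 1 → adj P₂ i k ≡ 1 → j ≡ k
  unique {0F} {1F} {1F} _ _ = refl
  unique {1F} {0F} {0F} _ _ = refl
  unique {0F} {0F}      () _
  unique {1F} {1F}      () _
  unique {0F} {1F} {0F} _ ()
  unique {1F} {0F} {1F} _ ()

isMatching-matchingGraph : ∀ j r → IsMatching (adj (matchingGraph j r))
isMatching-matchingGraph j r =
  isMatching-⊕ (isMatching-copies j isMatching-P₂)
               (isMatching-copies r (IsMatching-≤ᴬ (≤G⇒≤ᴬ {P₁} {P₂} P₁≤P₂) isMatching-P₂))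

induced : ∀ {m} (G : Graph) → (Fin m → Fin (size G)) → Graph
induced G f = graph _ (λ i j → adj G (f i) (f j)) (λ i j → adj-sym G (f i) (f j))

induced-≅ : ∀ {m} (σ : Fin m ↔ Fin (size G)) → induced G (Inverse.to σ) ≅ G
induced-≅ σ = σ , λ _ _ → refl

isMatching-induced : ∀ {m} {f : Fin m → Fin (size G)} →
                     IsMatching (adj G) → Injective _≡_ _≡_ f → IsMatching (adj (induced G f))
isMatching-induced μ f-injective = IsMatching-≤ᴬ (mk↣ f-injective , λ _ _ → refl) μ

isolated-split : ∀ {m A s} → (∀ k → A 0F k ≡ 0) →
                 graph (suc m) A s ≅ (P₁ ⊕ induced (graph (suc m) A s) suc)
isolated-split {s = s} A₀≡0 = ↔-refl , λ where
  0F      0F      → sym (A₀≡0 0F)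
  0F      (suc j) → sym (A₀≡0 (suc j))
  (suc i) 0F      → sym (trans (s (suc i) 0F) (A₀≡0 (suc i)))
  (suc i) (suc j) → refl

edge-split : ∀ {m A s} → IsMatching A → A 0F 1F ≡ 1 →
             graph (suc (suc m)) A s ≅ (P₂ ⊕ induced (graph (suc (suc m)) A s) (Fin.suc ∘ Fin.suc))
edge-split {s = s} μ e = ↔-refl , λ where
  0F            0F            → sym (loopless μ 0F)
  0F            1F            → sym e
  0F            (suc (suc j)) → sym (non-neighbour μ e λ ())
  1F            0F            → sym (trans (s 1F 0F) e)
  1F            1F            → sym (loopless μ 1F)
  1F            (suc (suc j)) → sym (non-neighbour μ (trans (s 1F 0F) e) λ ())
  (suc (suc i)) 0F            → sym (trans (s _ 0F) (non-neighbour μ e λ ()))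
  (suc (suc i)) 1F            → sym (trans (s _ 1F) (non-neighbour μ (trans (s 1F 0F) e) λ ()))
  (suc (suc i)) (suc (suc j)) → refl

mutual
  classify : ∀ m A s → IsMatching A → ∃₂ λ j r → graph m A s ≅ matchingGraph j r
  classify zero    A s μ = 0 , 0 , ↔-refl , λ ()
  classify (suc m) A s μ with any? (λ k → A 0F k ≟ 1)
  ... | yes (0F    , loop) = ⊥-elim (1+n≢0 (trans (sym loop) (loopless μ 0F)))
  ... | yes (suc u , edge) = classify-edge {s = s} μ u edge
  ... | no  no-edge        =
    let j , r , T≅ = classify m (adj T) (adj-sym T) (isMatching-induced {graph (suc m) A s} μ suc-injective)
    in j , suc r , (begin-equality
      graph (suc m) A s          ≈⟨ isolated-split {s = s} (λ k → ≢1⇒≡0 μ λ e → no-edge (k , e)) ⟩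
      P₁ ⊕ T                     ≈⟨ ⊕-cong (≅-refl {P₁}) T≅ ⟩
      P₁ ⊕ matchingGraph j r     ≈⟨ P₁⊕matchingGraph j r ⟩
      matchingGraph j (suc r)    ∎)
    where
    open ≤G-Reasoning
    T : Graph
    T = induced (graph (suc m) A s) Fin.suc

  classify-edge : ∀ {m A s} → IsMatching A → (u : Fin m) → A 0F (suc u) ≡ 1 →
                  ∃₂ λ j r → graph (suc m) A s ≅ matchingGraph j r
  classify-edge {suc m} {A} {s} μ u edge =
    let j , r , T≅ = classify m (adj T) (adj-sym T) (isMatching-induced {G₁} μ₁ (suc-injective ∘ suc-injective))
    in suc j , r , (begin-equality
      graph (suc (suc m)) A s    ≈⟨ induced-≅ {graph (suc (suc m)) A s} σ ⟨
      G₁                         ≈⟨ edge-split {s = adj-sym G₁} μ₁ edge ⟩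
      P₂ ⊕ T                     ≈⟨ ⊕-cong (≅-refl {P₂}) T≅ ⟩
      P₂ ⊕ matchingGraph j r     ≈⟨ P₂⊕matchingGraph j r ⟩
      matchingGraph (suc j) r    ∎)
    where
    open ≤G-Reasoning
    -- relabelling by this transposition makes the neighbour of vertex 0 vertex 1
    σ : Fin (suc (suc m)) ↔ Fin (suc (suc m))
    σ = transpose 1F (suc u)
    G₁ : Graph
    G₁ = induced (graph (suc (suc m)) A s) (Inverse.to σ)
    μ₁ : IsMatching (adj G₁)
    μ₁ = isMatching-induced {graph (suc (suc m)) A s} μ (Injection.injective (↔⇒↣ σ))
    T : Graph
    T = induced G₁ (Fin.suc ∘ Fin.suc)

matching-classification : ∀ G → IsMatching (adj G) → ∃₂ λ j r → G ≅ matchingGraph j r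
matching-classification G = classify (size G) (adj G) (adj-sym G)

-- Independence number versus clique covers

IsCliqueCover : Adj X → (X → Y) → Set
IsCliqueCover A g = ∀ x y → g x ≡ g y → x ≡ y ⊎ A x y ≢ 0

module _ {A : Adj X} where

  IsCliqueCover-≤ᴬ : {B : Adj Y} {g : Y → Z} (f : A ≤ᴬ B) →
                     IsCliqueCover B g → IsCliqueCover A (g ∘ Injection.to (_≤ᴬ_.embedding f))
  IsCliqueCover-≤ᴬ (f , p) cover x y gfx≡gfy with cover _ _ gfx≡gfy
  ... | inj₁ fx≡fy = inj₁ (Injection.injective f fx≡fy)
  ... | inj₂ fx≁fy = inj₂ λ x≁y → fx≁fy (trans (p x y) x≁y)

  IsCliqueCover-∘ : {g : X → Y} {h : Y → Z} →
                    Injective _≡_ _≡_ h → IsCliqueCover A g → IsCliqueCover A (h ∘ g)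
  IsCliqueCover-∘ h-injective cover x y hgx≡hgy = cover x y (h-injective hgx≡hgy)

  IsCliqueCover-⊕ᴬ : {B : Adj Y} {g : X → X′} {h : Y → Y′} →
                     IsCliqueCover A g → IsCliqueCover B h → IsCliqueCover (A ⊕ᴬ B) (Sum.map g h)
  IsCliqueCover-⊕ᴬ cg ch (inj₁ x) (inj₁ y) e with cg x y (inj₁-injective e)
  ... | inj₁ x≡y = inj₁ (cong inj₁ x≡y)
  ... | inj₂ x~y = inj₂ x~y
  IsCliqueCover-⊕ᴬ cg ch (inj₂ x) (inj₂ y) e with ch x y (inj₂-injective e)
  ... | inj₁ x≡y = inj₁ (cong inj₂ x≡y)
  ... | inj₂ x~y = inj₂ x~y

  edgeless-cover-injective : {g : X → Y} → (∀ x y → A x y ≡ 0) → IsCliqueCover A g →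
                             Injective _≡_ _≡_ g
  edgeless-cover-injective edgeless cover {x} {y} gx≡gy with cover x y gx≡gy
  ... | inj₁ x≡y = x≡y
  ... | inj₂ x~y = ⊥-elim (x~y (edgeless x y))

CliqueCover : Graph → ℕ → Set
CliqueCover G k = Σ (Fin (size G) → Fin k) (IsCliqueCover (adj G))

cliqueCover-⊕ : ∀ {k l} → CliqueCover G k → CliqueCover H l → CliqueCover (G ⊕ H) (k + l)
cliqueCover-⊕ {G} {H} {k} {l} (g , cg) (h , ch) =
  _ , IsCliqueCover-∘ (Injection.injective (↔⇒↣ (↔-sym (+↔⊎ {k} {l}))))
        (IsCliqueCover-≤ᴬ (≅ᴬ⇒≤ᴬ (adj-⊕ G H)) (IsCliqueCover-⊕ᴬ cg ch))

cliqueCover-copies : ∀ n → CliqueCover G 1 → CliqueCover (copies n G) n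
cliqueCover-copies zero    _ = (λ ()) , λ ()
cliqueCover-copies (suc n) c = cliqueCover-⊕ c (cliqueCover-copies n c)

cliqueCover-P₂ : CliqueCover P₂ 1
cliqueCover-P₂ = (λ _ → 0F) , λ where
  0F 0F _ → inj₁ refl
  0F 1F _ → inj₂ λ ()
  1F 0F _ → inj₂ λ ()
  1F 1F _ → inj₁ refl

cliqueCover-matchingGraph : ∀ j r → CliqueCover (matchingGraph j r) (j + r)
cliqueCover-matchingGraph j r =
  cliqueCover-⊕ (cliqueCover-copies j cliqueCover-P₂) (cliqueCover-copies r (id , λ _ _ → inj₁))

edgeless-size≤cliqueCover : ∀ {X k} → (∀ i j → adj X i j ≡ 0) → X ≤G G → CliqueCover G k → size X ≤ k
edgeless-size≤cliqueCover {G} {X} edgeless X≤G (g , cover) =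
  injective⇒≤ (edgeless-cover-injective edgeless (IsCliqueCover-≤ᴬ (≤G⇒≤ᴬ {X} {G} X≤G) cover))

P₁ⁿ-edgeless : ∀ n i j → adj (copies n P₁) i j ≡ 0
P₁ⁿ-edgeless (suc n) 0F      0F      = refl
P₁ⁿ-edgeless (suc n) 0F      (suc j) = refl
P₁ⁿ-edgeless (suc n) (suc i) 0F      = refl
P₁ⁿ-edgeless (suc n) (suc i) (suc j) = P₁ⁿ-edgeless n i j

size-P₁ⁿ : ∀ n → size (copies n P₁) ≡ n
size-P₁ⁿ n = trans (size-copies n P₁) (*-identityʳ n)

P₁ᵐ≤matchingGraph⇒≤ : ∀ m j r → copies m P₁ ≤G matchingGraph j r → m ≤ j + r
P₁ᵐ≤matchingGraph⇒≤ m j r P₁ᵐ≤M =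
  subst (_≤ j + r) (size-P₁ⁿ m)
    (edgeless-size≤cliqueCover {matchingGraph j r} {copies m P₁} (P₁ⁿ-edgeless m) P₁ᵐ≤M
                               (cliqueCover-matchingGraph j r))

P₁ʲ⁺ʳ≤matchingGraph : ∀ j r → copies (j + r) P₁ ≤G matchingGraph j r
P₁ʲ⁺ʳ≤matchingGraph j r = ≤G-trans {copies (j + r) P₁} {matchingGraph 0 (j + r)} {matchingGraph j r}
  (≤G-refl {copies (j + r) P₁}) (matchingGraph-mono 0 j r)

-- The Möbius function along a chain

Möbius-respʳ-≅ : ∀ {a b b′ z} → b ≅ b′ → Möbius a b z → Möbius a b′ z
Möbius-respʳ-≅ {a} {b} {b′} b≅b′ (μ-iso a≅b) = μ-iso (≅-trans {a} {b} {b′} a≅b b≅b′)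
Möbius-respʳ-≅ {a} {b} {b′} b≅b′ (μ-nle a≰b) =
  μ-nle λ a≤b′ → a≰b (≤G-trans {a} {b′} {b} a≤b′ (≅⇒≤G {b′} {b} (≅-sym {b} {b′} b≅b′)))
Möbius-respʳ-≅ {a} {b} {b′} b≅b′ (μ-step a≤b a≇b cs values interval complete distinct) =
  μ-step (proj₁ a<b′) (proj₂ a<b′) cs values
    (All.map (λ { {c , _} (a≤c , c<b) → a≤c , <G-respʳ-≅ {c} {b} {b′} b≅b′ c<b }) interval)
    (λ c a≤c c<b′ → complete c a≤c (<G-respʳ-≅ {c} {b′} {b} (≅-sym {b} {b′} b≅b′) c<b′))
    distinct
  where
  a<b′ : a <G b′
  a<b′ = <G-respʳ-≅ {a} {b} {b′} b≅b′ (a≤b , a≇b)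

chainMöbius : ℕ → ℤ
chainMöbius zero          = + 1
chainMöbius (suc zero)    = -[1+ 0 ]
chainMöbius (suc (suc _)) = + 0

module Chain {a : Graph} {n : ℕ} (C : ℕ → Graph)
  (a≅C₀        : a ≅ C 0)
  (C-mono      : ∀ {j k} → j ≤ k → k ≤ n → C j ≤G C k)
  (C-injective : ∀ {j k} → j ≤ n → k ≤ n → C j ≅ C k → j ≡ k)
  (C-complete  : ∀ {k} c → k ≤ n → a ≤G c → c <G C k → ∃[ j ] j < k × c ≅ C j)
  where

  below : ℕ → List (Graph × ℤ)
  below zero    = []
  below (suc k) = (C k , chainMöbius k) ∷ below k

  sum-below : ∀ k → - sumℤ (map proj₂ (below (suc k))) ≡ chainMöbius (suc k)
  sum-below zero          = refl
  sum-below (suc zero)    = refl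
  sum-below (suc (suc k)) = trans (cong -_ (+-identityˡ _)) (sum-below (suc k))

  a≤C : ∀ {k} → k ≤ n → a ≤G C k
  a≤C {k} k≤n = ≤G-trans {a} {C 0} {C k} (≅⇒≤G {a} {C 0} a≅C₀) (C-mono z≤n k≤n)

  C<C : ∀ {j k} → j < k → k ≤ n → C j <G C k
  C<C j<k k≤n =
    C-mono (<⇒≤ j<k) k≤n , λ Cj≅Ck → <⇒≢ j<k (C-injective (≤-trans (<⇒≤ j<k) k≤n) k≤n Cj≅Ck)

  below-interval : ∀ {m k} → m ≤ k → k ≤ n → All (λ p → a ≤G proj₁ p × proj₁ p <G C k) (below m)
  below-interval {zero}  _   _   = []
  below-interval {suc m} m<k k≤n =
    (a≤C (≤-trans (<⇒≤ m<k) k≤n) , C<C m<k k≤n) ∷ below-interval (<⇒≤ m<k) k≤n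

  below-complete : ∀ c {m j} → j < m → c ≅ C j → Any (λ p → c ≅ proj₁ p) (below m)
  below-complete c {suc m} {j} j<1+m c≅Cj with j ≟ m
  ... | yes refl = here c≅Cj
  ... | no  j≢m  = there (below-complete c (≤∧≢⇒< (≤-pred j<1+m) j≢m) c≅Cj)

  below-distinct : ∀ {m} → m ≤ n → AllPairs (λ p q → ¬ (proj₁ p ≅ proj₁ q)) (below m)
  below-distinct {zero}  _     = []
  below-distinct {suc m} 1+m≤n = distinct-from m ≤-refl ∷ below-distinct (<⇒≤ 1+m≤n)
    where
    distinct-from : ∀ i → i ≤ m → All (λ q → ¬ (C m ≅ proj₁ q)) (below i)
    distinct-from zero    _     = []
    distinct-from (suc i) 1+i≤m =
      (λ Cm≅Ci → <⇒≢ 1+i≤m (sym (C-injective (<⇒≤ 1+m≤n) (≤-trans (<⇒≤ 1+i≤m) (<⇒≤ 1+m≤n)) Cm≅Ci)))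
      ∷ distinct-from i (<⇒≤ 1+i≤m)

  möbius-chain : ∀ k → k ≤ n → Möbius a (C k) (chainMöbius k)
  möbius-below : ∀ k → k ≤ n → All (λ p → Möbius a (proj₁ p) (proj₂ p)) (below k)

  möbius-chain zero    _   = μ-iso a≅C₀
  möbius-chain (suc k) k<n = subst (Möbius a (C (suc k))) (sum-below k)
    (μ-step (a≤C k<n) a≇C (below (suc k)) (möbius-below (suc k) k<n) (below-interval ≤-refl k<n)
            (λ c a≤c c<C → let j , j<k , c≅Cj = C-complete c k<n a≤c c<C in below-complete c j<k c≅Cj)
            (below-distinct k<n))
    where
    a≇C : ¬ (a ≅ C (suc k))
    a≇C a≅C = 0≢1+n (C-injective z≤n k<n (≅-trans {C 0} {a} {C (suc k)} (≅-sym {a} {C 0} a≅C₀) a≅C))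

  möbius-below zero    _   = []
  möbius-below (suc k) k<n = möbius-chain k (<⇒≤ k<n) ∷ möbius-below k (<⇒≤ k<n)

module P₁ⁿ-P₂ⁿ-Interval (n : ℕ) where

  C : ℕ → Graph
  C k = matchingGraph k (n ∸ k)

  size-C : ∀ {k} → k ≤ n → size (C k) ≡ k + n
  size-C {k} k≤n = trans (size-matchingGraph k (n ∸ k)) (cong (λ m → k + m) (m+[n∸m]≡n k≤n))

  P₁ⁿ≅C₀ : P 1 n ≅ C 0
  P₁ⁿ≅C₀ = ≅-sym {C 0} {P 1 n} (⊕-identityˡ (P 1 n))

  C-mono : ∀ {j k} → j ≤ k → k ≤ n → C j ≤G C k
  C-mono {j} {k} j≤k k≤n =
    subst₂ (λ r k′ → matchingGraph j r ≤G matchingGraph k′ (n ∸ k)) gap (m+[n∸m]≡n j≤k)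
      (matchingGraph-mono j (k ∸ j) (n ∸ k))
    where
    gap : (k ∸ j) + (n ∸ k) ≡ n ∸ j
    gap = begin
      (k ∸ j) + (n ∸ k)   ≡⟨ +-comm (k ∸ j) (n ∸ k) ⟩
      (n ∸ k) + (k ∸ j)   ≡⟨ +-∸-assoc (n ∸ k) j≤k ⟨
      (n ∸ k) + k ∸ j     ≡⟨ cong (_∸ j) (m∸n+n≡m k≤n) ⟩
      n ∸ j               ∎
      where open ≡-Reasoning

  C-injective : ∀ {j k} → j ≤ n → k ≤ n → C j ≅ C k → j ≡ k
  C-injective {j} {k} j≤n k≤n Cj≅Ck =
    +-cancelʳ-≡ n j k (trans (sym (size-C j≤n)) (trans (≅-size {C j} {C k} Cj≅Ck) (size-C k≤n)))

  matchingGraph-between : ∀ {k j r} → k ≤ n → P 1 n ≤G matchingGraph j r → matchingGraph j r ≤G C k →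
                          j ≤ k × r ≡ n ∸ j
  matchingGraph-between {k} {j} {r} k≤n P₁ⁿ≤M M≤Ck = j≤k , r≡n∸j
    where
    j+r≤n : j + r ≤ n
    j+r≤n = subst (j + r ≤_) (m+[n∸m]≡n k≤n) (P₁ᵐ≤matchingGraph⇒≤ (j + r) k (n ∸ k)
      (≤G-trans {copies (j + r) P₁} {matchingGraph j r} {C k} (P₁ʲ⁺ʳ≤matchingGraph j r) M≤Ck))
    j+r≡n : j + r ≡ n
    j+r≡n = ≤-antisym j+r≤n (P₁ᵐ≤matchingGraph⇒≤ n j r P₁ⁿ≤M)
    r≡n∸j : r ≡ n ∸ j
    r≡n∸j = trans (sym (m+n∸m≡n j r)) (cong (_∸ j) j+r≡n)
    j≤k : j ≤ k
    j≤k = +-cancelʳ-≤ n j k (subst₂ _≤_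
      (trans (size-matchingGraph j r) (cong (λ m → j + m) j+r≡n)) (size-C k≤n)
      (≤G-size {matchingGraph j r} {C k} M≤Ck))

  C-complete : ∀ {k} c → k ≤ n → P 1 n ≤G c → c <G C k → ∃[ j ] j < k × c ≅ C j
  C-complete {k} c k≤n P₁ⁿ≤c (c≤Ck , c≇Ck) =
    let j , r , c≅M   = matching-classification c
                          (IsMatching-≤ᴬ (≤G⇒≤ᴬ {c} {C k} c≤Ck) (isMatching-matchingGraph k (n ∸ k)))
        M≅c           = ≅-sym {c} {matchingGraph j r} c≅M
        j≤k , r≡n∸j   = matchingGraph-between k≤n
                          (≤G-trans {P 1 n} {c} {matchingGraph j r} P₁ⁿ≤c (≅⇒≤G {c} {matchingGraph j r} c≅M))
                          (≤G-trans {matchingGraph j r} {c} {C k} (≅⇒≤G {matchingGraph j r} {c} M≅c) c≤Ck)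
        c≅Cj          = subst (λ r → c ≅ matchingGraph j r) r≡n∸j c≅M
    in j , ≤∧≢⇒< j≤k (λ j≡k → c≇Ck (subst (λ i → c ≅ C i) j≡k c≅Cj)) , c≅Cj

  open Chain {P 1 n} {n} C P₁ⁿ≅C₀ C-mono C-injective C-complete public

  Cₙ≅P₂ⁿ : C n ≅ P 2 n
  Cₙ≅P₂ⁿ = subst (λ r → matchingGraph n r ≅ P 2 n) (sym (n∸n≡0 n)) (⊕-identityʳ (P 2 n))

Möbius-P₁ⁿ-P₂ⁿ : ∀ n → Möbius (P 1 n) (P 2 n) (chainMöbius n)
Möbius-P₁ⁿ-P₂ⁿ n = Möbius-respʳ-≅ {P 1 n} {C n} {P 2 n} Cₙ≅P₂ⁿ (möbius-chain n ≤-refl)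
  where open P₁ⁿ-P₂ⁿ-Interval n

lemma4p15 : ∀ (n : ℕ) → 0 < n →
    Möbius (P 1 n) (P 1 n) (+ 1)
    × (n ≡ 1 → Möbius (P 1 n) (P 2 n) -[1+ 0 ])
    × (1 < n → Möbius (P 1 n) (P 2 n) (+ 0))
lemma4p15 n _ =
  μ-iso (≅-refl {P 1 n}) , (λ { refl → Möbius-P₁ⁿ-P₂ⁿ 1 }) , λ { (s≤s (s≤s _)) → Möbius-P₁ⁿ-P₂ⁿ n }
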